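{- Let $G$ be a connected graph with undeletable vertices $V^\infty\subseteq V(G)$ and border terminals $T_b\subseteq V(G)$, and suppose $G$ contains neither a $(q,k)$-good node separation nor a $(q,k)$-flower separation with regard to $T_b$. Then for any $Z\subseteq V(G)\setminus V^\infty$ with $|Z|\le k$, the graph $G\setminus Z$ contains at most $(2q+2)(2^k-1)+|T_b|+1$ connected components containing a vertex of $V(G)\setminus V^\infty$, and at most one of them has more than $q$ vertices not in $V^\infty$.
   Context: A triple $(Z,V_1,V_2)$ of subsets of $V(G)$ is a $(q,k)$-good node separation if $|Z|\le k$, $Z\cap V^\infty=\emptyset$, $V_1$ and $V_2$ are vertex sets of two different connected components of $G\setminus Z$, and $|V_1\setminus V^\infty|,|V_2\setminus V^\infty|>q$. A pair $(Z,(V_i)_{i=1}^\ell)$ is a $(q,k)$-flower separation in $G$ with regard to $T_b$ if: $1\le|Z|\le k$ and $Z\cap V^\infty=\emptyset$; the $V_i$ are vertex sets of pairwise different connected components of $G\setminus Z$; $V(G)\setminus(Z\cup\bigcup_i V_i)$ contains more than $q$ vertices not in $V^\infty$; for each $i$, $V_i\cap T_b=\emptyset$, $|V_i\setminus V^\infty|\le q$ and $N_G(V_i)=Z$; and $|(\bigcup_i V_i)\setminus V^\infty|>q$. -}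

module Defs where

open import Data.Nat using (ℕ; _≤_; _<_)
open import Data.Fin using (Fin)
open import Data.Fin.Subset using (Subset; _∈_; _∉_; _∩_; _∪_; ∁; ⋃; ∣_∣; ⊤)
open import Data.List using (tabulate)
open import Data.Product using (Σ; _×_; ∃)
open import Relation.Binary.PropositionalEquality using (_≡_; _≢_)
open import Relation.Nullary using (¬_)
open import Function.Bundles using (_⇔_)

record Graph (n : ℕ) : Set₁ where
  field
    E        : Fin n → Fin n → Set
    E-sym    : ∀ {u v} → E u v → E v u
    E-irrefl : ∀ {u} → ¬ E u u
open Graph public

_∖_ : ∀ {n} → Subset n → Subset n → Subset n
A ∖ B = A ∩ ∁ B

data Walk {n} (G : Graph n) (S : Subset n) : Fin n → Fin n → Set where
  here : ∀ {u} → u ∈ S → Walk G S u u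
  step : ∀ {u v w} → u ∈ S → E G u v → Walk G S v w → Walk G S u w

Connected : ∀ {n} → Graph n → Set
Connected {n} G = ∀ (u v : Fin n) → Walk G ⊤ u v

IsComponent : ∀ {n} → Graph n → Subset n → Subset n → Set
IsComponent {n} G Z C =
  (∃ λ x → x ∈ C) ×
  (∀ x → x ∈ C → x ∉ Z) ×
  (∀ x y → x ∈ C → (y ∈ C ⇔ Walk G (∁ Z) x y))

NeighbourhoodIs : ∀ {n} → Graph n → Subset n → Subset n → Set
NeighbourhoodIs {n} G V Z =
  ∀ (y : Fin n) → (y ∈ Z ⇔ (y ∉ V × ∃ λ x → x ∈ V × E G x y))

DisjointFrom : ∀ {n} → Subset n → Subset n → Set
DisjointFrom {n} Z W = ∀ (x : Fin n) → x ∈ Z → x ∉ W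

IsGoodNodeSep : ∀ {n} → Graph n → (Vinf : Subset n) → (q k : ℕ) →
                Subset n → Subset n → Subset n → Set
IsGoodNodeSep G Vinf q k Z V₁ V₂ =
  ∣ Z ∣ ≤ k × DisjointFrom Z Vinf ×
  IsComponent G Z V₁ × IsComponent G Z V₂ × V₁ ≢ V₂ ×
  q < ∣ V₁ ∖ Vinf ∣ × q < ∣ V₂ ∖ Vinf ∣

HasGoodNodeSep : ∀ {n} → Graph n → Subset n → ℕ → ℕ → Set
HasGoodNodeSep {n} G Vinf q k =
  Σ (Subset n) λ Z → Σ (Subset n) λ V₁ → Σ (Subset n) λ V₂ →
    IsGoodNodeSep G Vinf q k Z V₁ V₂

⋃ᶠ : ∀ {n ℓ} → (Fin ℓ → Subset n) → Subset n
⋃ᶠ Vs = ⋃ (tabulate Vs)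

IsFlowerSep : ∀ {n} → Graph n → (Vinf Tb : Subset n) → (q k : ℕ) →
              Subset n → (ℓ : ℕ) → (Fin ℓ → Subset n) → Set
IsFlowerSep G Vinf Tb q k Z ℓ Vs =
  1 ≤ ∣ Z ∣ × ∣ Z ∣ ≤ k × DisjointFrom Z Vinf ×
  (∀ i → IsComponent G Z (Vs i)) ×
  (∀ i j → Vs i ≡ Vs j → i ≡ j) ×
  q < ∣ ∁ (Z ∪ ⋃ᶠ Vs) ∖ Vinf ∣ ×
  (∀ i → DisjointFrom (Vs i) Tb) ×
  (∀ i → ∣ Vs i ∖ Vinf ∣ ≤ q) ×
  (∀ i → NeighbourhoodIs G (Vs i) Z) ×
  q < ∣ ⋃ᶠ Vs ∖ Vinf ∣

HasFlowerSep : ∀ {n} → Graph n → Subset n → Subset n → ℕ → ℕ → Set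
HasFlowerSep {n} G Vinf Tb q k =
  Σ (Subset n) λ Z → Σ ℕ λ ℓ → Σ (Fin ℓ → Subset n) λ Vs →
    IsFlowerSep G Vinf Tb q k Z ℓ Vs

-- Apart from at most |Tb| components meeting Tb and, as there is no good node separation, at most
-- one component with more than q vertices outside V∞, every component C of G ∖ Z avoids Tb, is
-- small and has a neighbourhood N(C) ⊆ Z, nonempty when Z is (G is connected). If 2q + 2 of them
-- had the same neighbourhood W, q + 1 of them would be the petals of a (q,k)-flower separation
-- with separator W, the other q + 1 making its remainder large. So each of the 2^|Z| − 1 nonempty
-- W ⊆ Z is the neighbourhood of at most 2q + 1 components.
module Submission where

open import Defs
open import Data.Bool.Properties using () renaming (_≟_ to _≟ᵇ_)
open import Data.Fin using (Fin; zero; suc; _↑ˡ_; _↑ʳ_; inject≤; splitAt)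
open import Data.Fin.Properties
  using (any?; suc-injective; injective⇒≤; ↑ˡ-injective; ↑ʳ-injective; inject≤-injective; splitAt-↑ˡ; splitAt-↑ʳ; sequence)
open import Data.Fin.Subset using (Subset; _∈_; _∉_; _∪_; ∁; ∣_∣; ⊤; ⊥; _⊆_; _-_; inside; outside; Nonempty)
open import Data.Fin.Subset.Properties
open import Data.Nat using (ℕ; zero; suc; _≤_; _<_; _+_; _*_; _∸_; _^_; z≤n; s≤s; _≤?_; _<?_)
open import Data.Nat.Properties hiding (suc-injective)
open import Data.Nat.Tactic.RingSolver using (solve-∀)
open import Data.Product using (_×_; ∃; _,_; proj₁; proj₂)
open import Data.Sum using (inj₁; inj₂)
open import Data.Vec using ([]; _∷_; here; there; tabulate)
open import Data.Vec.Properties using (lookup∘tabulate; []=⇒lookup; lookup⇒[]=; ≡-dec)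
open import Effect.Monad using (RawMonad)
open import Function.Bundles using (Equivalence; mk⇔)
open import Relation.Binary.PropositionalEquality using (_≡_; _≢_; refl; sym; trans; cong; subst; subst₂)
open import Relation.Nullary using (¬_; Dec; yes; no; does; contradiction)
open import Relation.Nullary.Decidable using (decidable-stable; ¬¬-excluded-middle; _×-dec_; ¬?)
open import Relation.Nullary.Negation using (¬¬-Monad; ¬¬-map)

open Equivalence

select : ∀ {n} {P : Fin n → Set} → (∀ x → Dec (P x)) → Subset n
select P? = tabulate (λ x → does (P? x))

∈-select⁺ : ∀ {n} {P : Fin n → Set} (P? : ∀ x → Dec (P x)) {x} → P x → x ∈ select P?
∈-select⁺ P? {x} p with P? x in eq
... | yes _ = lookup⇒[]= x _ (trans (lookup∘tabulate _ x) (cong does eq))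
... | no ¬p = contradiction p ¬p

∈-select⁻ : ∀ {n} {P : Fin n → Set} (P? : ∀ x → Dec (P x)) {x} → x ∈ select P? → P x
∈-select⁻ P? {x} x∈ with P? x in eq
... | yes p = p
... | no _ with trans (sym (cong does eq)) (trans (sym (lookup∘tabulate (λ y → does (P? y)) x)) ([]=⇒lookup x∈))
...   | ()

enum : ∀ {n} (p : Subset n) → Fin ∣ p ∣ → Fin n
enum (outside ∷ p) i       = suc (enum p i)
enum (inside ∷ p)  zero    = zero
enum (inside ∷ p)  (suc i) = suc (enum p i)

enum-∈ : ∀ {n} (p : Subset n) i → enum p i ∈ p
enum-∈ (outside ∷ p) i       = there (enum-∈ p i)
enum-∈ (inside ∷ p)  zero    = here
enum-∈ (inside ∷ p)  (suc i) = there (enum-∈ p i)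

enum-injective : ∀ {n} (p : Subset n) i j → enum p i ≡ enum p j → i ≡ j
enum-injective (outside ∷ p) i       j       eq = enum-injective p i j (suc-injective eq)
enum-injective (inside ∷ p)  zero    zero    _  = refl
enum-injective (inside ∷ p)  (suc i) (suc j) eq = cong suc (enum-injective p i j (suc-injective eq))

injective⇒≤∣p∣ : ∀ {m n} {p : Subset n} (f : Fin m → Fin n) →
  (∀ i j → f i ≡ f j → i ≡ j) → (∀ i → f i ∈ p) → m ≤ ∣ p ∣
injective⇒≤∣p∣ {zero}  f _   _   = z≤n
injective⇒≤∣p∣ {suc m} {p = p} f inj f∈p = begin-strict
  m                   ≤⟨ injective⇒≤∣p∣ (λ i → f (suc i)) (λ i j eq → suc-injective (inj _ _ eq)) f-suc∈ ⟩
  ∣ p - f zero ∣       <⟨ x∈p⇒∣p-x∣<∣p∣ (f∈p zero) ⟩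
  ∣ p ∣                ∎
  where
  open ≤-Reasoning
  f-suc∈ : ∀ i → f (suc i) ∈ p - f zero
  f-suc∈ i = x∈p∧x≢y⇒x∈p-y (f∈p (suc i)) (λ eq → contradiction (inj _ _ eq) λ ())

∣p∣≤1 : ∀ {n} (p : Subset n) → (∀ {x y} → x ∈ p → y ∈ p → x ≡ y) → ∣ p ∣ ≤ 1
∣p∣≤1 p all-equal = injective⇒≤ {f = λ _ → zero}
  (λ {i} {j} _ → enum-injective p i j (all-equal (enum-∈ p i) (enum-∈ p j)))

∣p∪q∣≤∣p∣+∣q∣ : ∀ {n} (p q : Subset n) → ∣ p ∪ q ∣ ≤ ∣ p ∣ + ∣ q ∣
∣p∪q∣≤∣p∣+∣q∣ []            []            = z≤n
∣p∪q∣≤∣p∣+∣q∣ (outside ∷ p) (outside ∷ q) = ∣p∪q∣≤∣p∣+∣q∣ p q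
∣p∪q∣≤∣p∣+∣q∣ (outside ∷ p) (inside ∷ q)  =
  subst (suc ∣ p ∪ q ∣ ≤_) (sym (+-suc ∣ p ∣ ∣ q ∣)) (s≤s (∣p∪q∣≤∣p∣+∣q∣ p q))
∣p∪q∣≤∣p∣+∣q∣ (inside ∷ p)  (outside ∷ q) = s≤s (∣p∪q∣≤∣p∣+∣q∣ p q)
∣p∪q∣≤∣p∣+∣q∣ (inside ∷ p)  (inside ∷ q)  =
  s≤s (≤-trans (∣p∪q∣≤∣p∣+∣q∣ p q) (+-monoʳ-≤ ∣ p ∣ (n≤1+n ∣ q ∣)))

⋃ᶠ⁺ : ∀ {n ℓ} (Vs : Fin ℓ → Subset n) i {x} → x ∈ Vs i → x ∈ ⋃ᶠ Vs
⋃ᶠ⁺ Vs zero    x∈ = x∈p∪q⁺ (inj₁ x∈)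
⋃ᶠ⁺ Vs (suc i) x∈ = x∈p∪q⁺ (inj₂ (⋃ᶠ⁺ (λ j → Vs (suc j)) i x∈))

⋃ᶠ⁻ : ∀ {n ℓ} (Vs : Fin ℓ → Subset n) {x} → x ∈ ⋃ᶠ Vs → ∃ λ i → x ∈ Vs i
⋃ᶠ⁻ {ℓ = zero}  Vs x∈ = contradiction x∈ ∉⊥
⋃ᶠ⁻ {ℓ = suc ℓ} Vs x∈ with x∈p∪q⁻ (Vs zero) (⋃ᶠ (λ j → Vs (suc j))) x∈
... | inj₁ x∈V₀ = zero , x∈V₀
... | inj₂ x∈⋃ with ⋃ᶠ⁻ (λ j → Vs (suc j)) x∈⋃
...   | i , x∈Vᵢ = suc i , x∈Vᵢ

-- ⋃⊆ f Z is the union of f W over all W ⊆ Z, and ⋃⊆⁺ f Z the union over the nonempty ones.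
⋃⊆ : ∀ {n m} → (Subset n → Subset m) → Subset n → Subset m
⋃⊆ f []            = f []
⋃⊆ f (outside ∷ Z) = ⋃⊆ (λ W → f (outside ∷ W)) Z
⋃⊆ f (inside ∷ Z)  = ⋃⊆ (λ W → f (outside ∷ W)) Z ∪ ⋃⊆ (λ W → f (inside ∷ W)) Z

⋃⊆⁺ : ∀ {n m} → (Subset n → Subset m) → Subset n → Subset m
⋃⊆⁺ f []            = ⊥
⋃⊆⁺ f (outside ∷ Z) = ⋃⊆⁺ (λ W → f (outside ∷ W)) Z
⋃⊆⁺ f (inside ∷ Z)  = ⋃⊆⁺ (λ W → f (outside ∷ W)) Z ∪ ⋃⊆ (λ W → f (inside ∷ W)) Z

∈-⋃⊆ : ∀ {n m} (f : Subset n → Subset m) Z W {x} → W ⊆ Z → x ∈ f W → x ∈ ⋃⊆ f Z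
∈-⋃⊆ f []            []            _   x∈ = x∈
∈-⋃⊆ f (outside ∷ Z) (outside ∷ W) W⊆Z x∈ = ∈-⋃⊆ _ Z W (drop-∷-⊆ W⊆Z) x∈
∈-⋃⊆ f (outside ∷ Z) (inside ∷ W)  W⊆Z x∈ with W⊆Z here
... | ()
∈-⋃⊆ f (inside ∷ Z)  (outside ∷ W) W⊆Z x∈ = x∈p∪q⁺ (inj₁ (∈-⋃⊆ _ Z W (drop-∷-⊆ W⊆Z) x∈))
∈-⋃⊆ f (inside ∷ Z)  (inside ∷ W)  W⊆Z x∈ = x∈p∪q⁺ (inj₂ (∈-⋃⊆ _ Z W (drop-∷-⊆ W⊆Z) x∈))

∈-⋃⊆⁺ : ∀ {n m} (f : Subset n → Subset m) Z W {x} → W ⊆ Z → Nonempty W → x ∈ f W → x ∈ ⋃⊆⁺ f Z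
∈-⋃⊆⁺ f (outside ∷ Z) (outside ∷ W) W⊆Z (suc w , there w∈W) x∈ =
  ∈-⋃⊆⁺ _ Z W (drop-∷-⊆ W⊆Z) (w , w∈W) x∈
∈-⋃⊆⁺ f (outside ∷ Z) (inside ∷ W)  W⊆Z _ x∈ with W⊆Z here
... | ()
∈-⋃⊆⁺ f (inside ∷ Z)  (outside ∷ W) W⊆Z (suc w , there w∈W) x∈ =
  x∈p∪q⁺ (inj₁ (∈-⋃⊆⁺ _ Z W (drop-∷-⊆ W⊆Z) (w , w∈W) x∈))
∈-⋃⊆⁺ f (inside ∷ Z)  (inside ∷ W)  W⊆Z _ x∈ = x∈p∪q⁺ (inj₂ (∈-⋃⊆ _ Z W (drop-∷-⊆ W⊆Z) x∈))

2^suc-split : ∀ z F → 2 ^ suc z * F ≡ 2 ^ z * F + 2 ^ z * F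
2^suc-split z F = double (2 ^ z) F
  where
  double : ∀ x F → 2 * x * F ≡ x * F + x * F
  double = solve-∀

∣⋃⊆∣≤ : ∀ {n m} (f : Subset n → Subset m) {F} → (∀ W → ∣ f W ∣ ≤ F) → ∀ Z → ∣ ⋃⊆ f Z ∣ ≤ 2 ^ ∣ Z ∣ * F
∣⋃⊆∣≤ f {F} bound []            = subst (∣ f [] ∣ ≤_) (sym (+-identityʳ F)) (bound [])
∣⋃⊆∣≤ f     bound (outside ∷ Z) = ∣⋃⊆∣≤ _ (λ _ → bound _) Z
∣⋃⊆∣≤ {m = m} f {F} bound (inside ∷ Z)  = begin
  ∣ A ∪ B ∣                      ≤⟨ ∣p∪q∣≤∣p∣+∣q∣ A B ⟩
  ∣ A ∣ + ∣ B ∣                  ≤⟨ +-mono-≤ (∣⋃⊆∣≤ _ (λ _ → bound _) Z) (∣⋃⊆∣≤ _ (λ _ → bound _) Z) ⟩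
  2 ^ ∣ Z ∣ * F + 2 ^ ∣ Z ∣ * F  ≡⟨ 2^suc-split ∣ Z ∣ F ⟨
  2 ^ suc ∣ Z ∣ * F              ∎
  where
  open ≤-Reasoning
  A B : Subset m
  A = ⋃⊆ (λ W → f (outside ∷ W)) Z
  B = ⋃⊆ (λ W → f (inside ∷ W)) Z

∣⋃⊆⁺∣≤ : ∀ {n m} (f : Subset n → Subset m) {F} → (∀ W → ∣ f W ∣ ≤ F) → ∀ Z →
  ∣ ⋃⊆⁺ f Z ∣ ≤ (2 ^ ∣ Z ∣ ∸ 1) * F
∣⋃⊆⁺∣≤ f {F} bound Z = subst (∣ ⋃⊆⁺ f Z ∣ ≤_) 2^zF∸F≡ (m+n≤o⇒m≤o∸n _ (∣⋃⊆⁺∣+F≤ f bound Z))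
  where
  2^zF∸F≡ : 2 ^ ∣ Z ∣ * F ∸ F ≡ (2 ^ ∣ Z ∣ ∸ 1) * F
  2^zF∸F≡ = trans (cong (2 ^ ∣ Z ∣ * F ∸_) (sym (*-identityˡ F))) (sym (*-distribʳ-∸ F (2 ^ ∣ Z ∣) 1))

  -- The empty W is missing from ⋃⊆⁺, which is accounted for by the extra F.
  ∣⋃⊆⁺∣+F≤ : ∀ {n m} (f : Subset n → Subset m) → (∀ W → ∣ f W ∣ ≤ F) → ∀ Z →
    ∣ ⋃⊆⁺ f Z ∣ + F ≤ 2 ^ ∣ Z ∣ * F
  ∣⋃⊆⁺∣+F≤ {m = m} f bound [] =
    subst₂ _≤_ (cong (_+ F) (sym (∣⊥∣≡0 m))) (sym (+-identityʳ F)) ≤-refl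
  ∣⋃⊆⁺∣+F≤ f bound (outside ∷ Z) = ∣⋃⊆⁺∣+F≤ _ (λ _ → bound _) Z
  ∣⋃⊆⁺∣+F≤ {m = m} f bound (inside ∷ Z) = begin
    ∣ A ∪ B ∣ + F                  ≤⟨ +-monoˡ-≤ F (∣p∪q∣≤∣p∣+∣q∣ A B) ⟩
    ∣ A ∣ + ∣ B ∣ + F              ≡⟨ +-shuffle ∣ A ∣ ∣ B ∣ F ⟩
    (∣ A ∣ + F) + ∣ B ∣            ≤⟨ +-mono-≤ (∣⋃⊆⁺∣+F≤ _ (λ _ → bound _) Z) (∣⋃⊆∣≤ _ (λ _ → bound _) Z) ⟩
    2 ^ ∣ Z ∣ * F + 2 ^ ∣ Z ∣ * F  ≡⟨ 2^suc-split ∣ Z ∣ F ⟨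
    2 ^ suc ∣ Z ∣ * F              ∎
    where
    open ≤-Reasoning
    A B : Subset m
    A = ⋃⊆⁺ (λ W → f (outside ∷ W)) Z
    B = ⋃⊆ (λ W → f (inside ∷ W)) Z
    +-shuffle : ∀ a b c → a + b + c ≡ a + c + b
    +-shuffle = solve-∀

module _ {n} {G : Graph n} where

  walk-head : ∀ {S u v} → Walk G S u v → u ∈ S
  walk-head (here u∈S)     = u∈S
  walk-head (step u∈S _ _) = u∈S

  walk-mono : ∀ {S S′ : Subset n} → S ⊆ S′ → ∀ {u v} → Walk G S u v → Walk G S′ u v
  walk-mono S⊆S′ (here u∈S)     = here (S⊆S′ u∈S)
  walk-mono S⊆S′ (step u∈S e w) = step (S⊆S′ u∈S) e (walk-mono S⊆S′ w)

  components-overlap⇒≡ : ∀ {Z C₁ C₂ x} → IsComponent G Z C₁ → IsComponent G Z C₂ →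
    x ∈ C₁ → x ∈ C₂ → C₁ ≡ C₂
  components-overlap⇒≡ {x = x} (_ , _ , walks₁) (_ , _ , walks₂) x∈C₁ x∈C₂ = ⊆-antisym
    (λ {y} y∈C₁ → from (walks₂ x y x∈C₂) (to (walks₁ x y x∈C₁) y∈C₁))
    (λ {y} y∈C₂ → from (walks₁ x y x∈C₁) (to (walks₂ x y x∈C₂) y∈C₂))

  connected⇒component-unique : Connected G → ∀ {Z C₁ C₂} → ¬ Nonempty Z →
    IsComponent G Z C₁ → IsComponent G Z C₂ → C₁ ≡ C₂
  connected⇒component-unique connected {Z} Z≡∅ c₁@((x , x∈C₁) , _ , walks₁) c₂@((y , y∈C₂) , _ , _) =
    components-overlap⇒≡ c₁ c₂ (from (walks₁ x y x∈C₁) walk) y∈C₂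
    where
    walk : Walk G (∁ Z) x y
    walk = walk-mono (λ {v} _ → x∉p⇒x∈∁p (λ v∈Z → Z≡∅ (v , v∈Z))) (connected x y)

  -- Distinct components are disjoint, so members chosen in them are distinct.
  components-meeting-p⇒≤∣p∣ : ∀ {Z m} {p : Subset n} (Cs : Fin m → Subset n) →
    (∀ i → IsComponent G Z (Cs i)) → (∀ i j → Cs i ≡ Cs j → i ≡ j) →
    (∀ i → ∃ λ x → x ∈ Cs i × x ∈ p) → m ≤ ∣ p ∣
  components-meeting-p⇒≤∣p∣ Cs comps distinct meet =
    injective⇒≤∣p∣ (λ i → proj₁ (meet i)) member-injective (λ i → proj₂ (proj₂ (meet i)))
    where
    member-injective : ∀ i j → proj₁ (meet i) ≡ proj₁ (meet j) → i ≡ j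
    member-injective i j eq = distinct i j (components-overlap⇒≡ (comps i) (comps j)
      (proj₁ (proj₂ (meet i))) (subst (_∈ Cs j) (sym eq) (proj₁ (proj₂ (meet j)))))

  neighbourhood⊆separator : ∀ {Z C W} → IsComponent G Z C → NeighbourhoodIs G C W → W ⊆ Z
  neighbourhood⊆separator {Z} (_ , C∩Z=∅ , walks) N≡W {y} y∈W with to (N≡W y) y∈W
  ... | y∉C , x , x∈C , xy with y ∈? Z
  ...   | yes y∈Z = y∈Z
  ...   | no  y∉Z = contradiction
          (from (walks x y x∈C) (step (x∉p⇒x∈∁p (C∩Z=∅ x x∈C)) xy (here (x∉p⇒x∈∁p y∉Z)))) y∉C

  neighbourhood-nonempty : Connected G → ∀ {Z C W z} → IsComponent G Z C → NeighbourhoodIs G C W →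
    z ∈ Z → Nonempty W
  neighbourhood-nonempty connected {Z} {C} {W} {z} ((x , x∈C) , C∩Z=∅ , _) N≡W z∈Z = leave x∈C (connected x z)
    where
    leave : ∀ {u} → u ∈ C → Walk G ⊤ u z → Nonempty W
    leave u∈C (here _) = contradiction z∈Z (C∩Z=∅ _ u∈C)
    leave {u} u∈C (step {v = v} _ uv w) with v ∈? C
    ... | yes v∈C = leave v∈C w
    ... | no  v∉C = v , from (N≡W v) (v∉C , u , u∈C , uv)

  -- A component of G ∖ Z is already a component of G ∖ N(C): its walks can only leave C through N(C).
  component-of-neighbourhood : ∀ {Z C W} → IsComponent G Z C → NeighbourhoodIs G C W → W ⊆ Z →
    IsComponent G W C
  component-of-neighbourhood {Z} {C} {W} (C≢∅ , C∩Z=∅ , walks) N≡W W⊆Z =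
    C≢∅ , (λ x x∈C x∈W → C∩Z=∅ x x∈C (W⊆Z x∈W)) ,
    λ x y x∈C → mk⇔ (λ y∈C → walk-mono ∁Z⊆∁W (to (walks x y x∈C) y∈C)) (stays x∈C)
    where
    ∁Z⊆∁W : ∁ Z ⊆ ∁ W
    ∁Z⊆∁W v∈∁Z = x∉p⇒x∈∁p (λ v∈W → x∈∁p⇒x∉p v∈∁Z (W⊆Z v∈W))
    stays : ∀ {u y} → u ∈ C → Walk G (∁ W) u y → y ∈ C
    stays u∈C (here _) = u∈C
    stays {u} u∈C (step {v = v} _ uv w) with v ∈? C
    ... | yes v∈C = stays v∈C w
    ... | no  v∉C = contradiction (from (N≡W v) (v∉C , u , u∈C , uv)) (x∈∁p⇒x∉p (walk-head w))

module _ {n} (G : Graph n) (E? : ∀ x y → Dec (E G x y)) where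

  neighbour? : ∀ C y → Dec (y ∉ C × ∃ λ x → x ∈ C × E G x y)
  neighbour? C y = ¬? (y ∈? C) ×-dec any? (λ x → (x ∈? C) ×-dec E? x y)

  N : Subset n → Subset n
  N C = select (neighbour? C)

  N-spec : ∀ C → NeighbourhoodIs G C (N C)
  N-spec C y = mk⇔ (∈-select⁻ (neighbour? C)) (∈-select⁺ (neighbour? C))

module _ {n} (G : Graph n) (Vinf Tb : Subset n) (q k : ℕ) where

  large-components-unique : ¬ HasGoodNodeSep G Vinf q k →
    ∀ {Z} → DisjointFrom Z Vinf → ∣ Z ∣ ≤ k →
    ∀ C₁ C₂ → IsComponent G Z C₁ → IsComponent G Z C₂ →
    q < ∣ C₁ ∖ Vinf ∣ → q < ∣ C₂ ∖ Vinf ∣ → C₁ ≡ C₂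
  large-components-unique noGood {Z} Z∩Vinf=∅ ∣Z∣≤k C₁ C₂ c₁ c₂ large₁ large₂ =
    decidable-stable (≡-dec _≟ᵇ_ C₁ C₂)
      (λ C₁≢C₂ → noGood (Z , C₁ , C₂ , ∣Z∣≤k , Z∩Vinf=∅ , c₁ , c₂ , C₁≢C₂ , large₁ , large₂))

  petals-form-flower : ∀ {W} → Nonempty W → DisjointFrom W Vinf → ∣ W ∣ ≤ k →
    (Cs : Fin (suc q + suc q) → Subset n) →
    (∀ i → IsComponent G W (Cs i)) → (∀ i j → Cs i ≡ Cs j → i ≡ j) →
    (∀ i → ∃ λ x → x ∈ Cs i × x ∉ Vinf) →
    (∀ i → DisjointFrom (Cs i) Tb) → (∀ i → ∣ Cs i ∖ Vinf ∣ ≤ q) → (∀ i → NeighbourhoodIs G (Cs i) W) →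
    IsFlowerSep G Vinf Tb q k W (suc q) (λ i → Cs (i ↑ˡ suc q))
  petals-form-flower {W} (w , w∈W) W∩Vinf=∅ ∣W∣≤k Cs comps distinct wit noTb small N≡W =
    injective⇒≤∣p∣ (λ _ → w) (λ { zero zero _ → refl }) (λ _ → w∈W) , ∣W∣≤k , W∩Vinf=∅ ,
    (λ i → comps (i ↑ˡ suc q)) , (λ i j eq → ↑ˡ-injective (suc q) i j (distinct _ _ eq)) ,
    rest-large , (λ i → noTb _) , (λ i → small _) , (λ i → N≡W _) , petals-large
    where
    Vs Rs : Fin (suc q) → Subset n
    Vs i = Cs (i ↑ˡ suc q)
    Rs j = Cs (suc q ↑ʳ j)

    ↑ˡ≢↑ʳ : ∀ i j → i ↑ˡ suc q ≢ suc q ↑ʳ j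
    ↑ˡ≢↑ʳ i j eq = contradiction
      (trans (sym (splitAt-↑ˡ (suc q) i (suc q))) (trans (cong (splitAt (suc q)) eq) (splitAt-↑ʳ (suc q) (suc q) j)))
      λ ()

    petals-large : q < ∣ ⋃ᶠ Vs ∖ Vinf ∣
    petals-large = components-meeting-p⇒≤∣p∣ Vs (λ i → comps _)
      (λ i j eq → ↑ˡ-injective (suc q) i j (distinct _ _ eq))
      (λ i → let x , x∈Vᵢ , x∉Vinf = wit (i ↑ˡ suc q) in
             x , x∈Vᵢ , x∈p∩q⁺ (⋃ᶠ⁺ Vs i x∈Vᵢ , x∉p⇒x∈∁p x∉Vinf))

    rest-large : q < ∣ ∁ (W ∪ ⋃ᶠ Vs) ∖ Vinf ∣
    rest-large = components-meeting-p⇒≤∣p∣ Rs (λ j → comps _)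
      (λ i j eq → ↑ʳ-injective (suc q) i j (distinct _ _ eq))
      (λ j → let x , x∈Rⱼ , x∉Vinf = wit (suc q ↑ʳ j) in
             x , x∈Rⱼ , x∈p∩q⁺ (x∉p⇒x∈∁p (outside-W∪petals j x∈Rⱼ) , x∉p⇒x∈∁p x∉Vinf))
      where
      outside-W∪petals : ∀ j {x} → x ∈ Rs j → x ∉ W ∪ ⋃ᶠ Vs
      outside-W∪petals j {x} x∈Rⱼ x∈W∪⋃ with x∈p∪q⁻ W (⋃ᶠ Vs) x∈W∪⋃
      ... | inj₁ x∈W = proj₁ (proj₂ (comps _)) x x∈Rⱼ x∈W
      ... | inj₂ x∈⋃ with ⋃ᶠ⁻ Vs x∈⋃
      ...   | i , x∈Vᵢ = ↑ˡ≢↑ʳ i j (distinct _ _ (components-overlap⇒≡ (comps _) (comps _) x∈Vᵢ x∈Rⱼ))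

module Counting {n} (G : Graph n) (Vinf Tb : Subset n) (q k : ℕ)
  (connected : Connected G) (noGood : ¬ HasGoodNodeSep G Vinf q k) (noFlower : ¬ HasFlowerSep G Vinf Tb q k)
  {Z : Subset n} (Z∩Vinf=∅ : DisjointFrom Z Vinf) (∣Z∣≤k : ∣ Z ∣ ≤ k)
  (E? : ∀ x y → Dec (E G x y))
  {ℓ} (Cs : Fin ℓ → Subset n) (comps : ∀ i → IsComponent G Z (Cs i)) (distinct : ∀ i j → Cs i ≡ Cs j → i ≡ j)
  (wit : ∀ i → ∃ λ x → x ∈ Cs i × x ∉ Vinf) where

  MeetsTb Large : Fin ℓ → Set
  MeetsTb i = ∃ λ x → x ∈ Cs i × x ∈ Tb
  Large i = q < ∣ Cs i ∖ Vinf ∣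

  AttachedTo : Subset n → Fin ℓ → Set
  AttachedTo W i = ¬ MeetsTb i × ¬ Large i × N G E? (Cs i) ≡ W

  meetsTb? : ∀ i → Dec (MeetsTb i)
  meetsTb? i = any? (λ x → (x ∈? Cs i) ×-dec (x ∈? Tb))

  large? : ∀ i → Dec (Large i)
  large? i = q <? ∣ Cs i ∖ Vinf ∣

  attachedTo? : ∀ W i → Dec (AttachedTo W i)
  attachedTo? W i = ¬? (meetsTb? i) ×-dec (¬? (large? i) ×-dec ≡-dec _≟ᵇ_ (N G E? (Cs i)) W)

  ∣meetsTb∣≤∣Tb∣ : ∣ select meetsTb? ∣ ≤ ∣ Tb ∣
  ∣meetsTb∣≤∣Tb∣ = components-meeting-p⇒≤∣p∣ (λ a → Cs (e a)) (λ a → comps (e a))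
    (λ a b eq → enum-injective _ a b (distinct _ _ eq)) (λ a → ∈-select⁻ meetsTb? (enum-∈ _ a))
    where
    e : Fin ∣ select meetsTb? ∣ → Fin ℓ
    e = enum (select meetsTb?)

  ∣large∣≤1 : ∣ select large? ∣ ≤ 1
  ∣large∣≤1 = ∣p∣≤1 _ (λ i∈ j∈ → distinct _ _ (large-components-unique G Vinf Tb q k noGood Z∩Vinf=∅ ∣Z∣≤k
    _ _ (comps _) (comps _) (∈-select⁻ large? i∈) (∈-select⁻ large? j∈)))

  many-attached⇒flower : ∀ {z} W → z ∈ Z → suc q + suc q ≤ ∣ select (attachedTo? W) ∣ → HasFlowerSep G Vinf Tb q k
  many-attached⇒flower W z∈Z 2q+2≤ =
    W , suc q , _ , petals-form-flower G Vinf Tb q k W≢∅ (λ x x∈W → Z∩Vinf=∅ x (W⊆Z x∈W))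
      (≤-trans (p⊆q⇒∣p∣≤∣q∣ W⊆Z) ∣Z∣≤k) (λ a → Cs (c a))
      (λ a → component-of-neighbourhood (comps _) (N≡W a) W⊆Z)
      (λ a b eq → inject≤-injective _ _ a b (enum-injective _ _ _ (distinct _ _ eq)))
      (λ a → wit _) (λ a x x∈ x∈Tb → proj₁ (attached a) (x , x∈ , x∈Tb))
      (λ a → ≮⇒≥ (proj₁ (proj₂ (attached a)))) N≡W
    where
    c : Fin (suc q + suc q) → Fin ℓ
    c a = enum (select (attachedTo? W)) (inject≤ a 2q+2≤)
    attached : ∀ a → AttachedTo W (c a)
    attached a = ∈-select⁻ (attachedTo? W) (enum-∈ _ _)
    N≡W : ∀ a → NeighbourhoodIs G (Cs (c a)) W
    N≡W a = subst (NeighbourhoodIs G (Cs (c a))) (proj₂ (proj₂ (attached a))) (N-spec G E? _)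
    W⊆Z : W ⊆ Z
    W⊆Z = neighbourhood⊆separator (comps (c zero)) (N≡W zero)
    W≢∅ : Nonempty W
    W≢∅ = neighbourhood-nonempty connected (comps (c zero)) (N≡W zero) z∈Z

  ∣attachedTo∣≤2q+1 : ∀ {z} → z ∈ Z → ∀ W → ∣ select (attachedTo? W) ∣ ≤ 2 * q + 1
  ∣attachedTo∣≤2q+1 z∈Z W with ∣ select (attachedTo? W) ∣ ≤? 2 * q + 1
  ... | yes ≤2q+1 = ≤2q+1
  ... | no  ≰2q+1 = contradiction
      (many-attached⇒flower W z∈Z (subst (_≤ ∣ select (attachedTo? W) ∣) (2q+2≡ q) (≰⇒> ≰2q+1))) noFlower
    where
    2q+2≡ : ∀ q → suc (2 * q + 1) ≡ suc q + suc q
    2q+2≡ = solve-∀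

  count : ℓ ≤ (2 * q + 2) * (2 ^ k ∸ 1) + ∣ Tb ∣ + 1
  count with nonempty? Z
  ... | no Z≡∅ = ≤-trans
        (injective⇒≤ {f = λ _ → zero} λ {i} {j} _ →
          distinct i j (connected⇒component-unique connected Z≡∅ (comps i) (comps j)))
        (m≤n+m 1 _)
  ... | yes (z , z∈Z) = begin
    ℓ                                        ≡⟨ ∣⊤∣≡n ℓ ⟨
    ∣ ⊤ {ℓ} ∣                                ≤⟨ p⊆q⇒∣p∣≤∣q∣ {p = ⊤} (λ {i} _ → classified i) ⟩
    ∣ T ∪ (L ∪ A) ∣                          ≤⟨ ∣p∪q∣≤∣p∣+∣q∣ T (L ∪ A) ⟩
    ∣ T ∣ + ∣ L ∪ A ∣                        ≤⟨ +-monoʳ-≤ ∣ T ∣ (∣p∪q∣≤∣p∣+∣q∣ L A) ⟩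
    ∣ T ∣ + (∣ L ∣ + ∣ A ∣)                  ≤⟨ +-mono-≤ ∣meetsTb∣≤∣Tb∣ (+-monoˡ-≤ ∣ A ∣ ∣large∣≤1) ⟩
    ∣ Tb ∣ + (1 + ∣ A ∣)                     ≡⟨ rearrange ∣ Tb ∣ ∣ A ∣ ⟩
    ∣ A ∣ + ∣ Tb ∣ + 1                       ≤⟨ +-monoˡ-≤ 1 (+-monoˡ-≤ ∣ Tb ∣ ∣A∣≤) ⟩
    (2 * q + 2) * (2 ^ k ∸ 1) + ∣ Tb ∣ + 1   ∎
    where
    open ≤-Reasoning
    T L A : Subset ℓ
    T = select meetsTb?
    L = select large?
    A = ⋃⊆⁺ (λ W → select (attachedTo? W)) Z

    classified : ∀ i → i ∈ T ∪ (L ∪ A)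
    classified i with meetsTb? i | large? i
    ... | yes meets | _         = x∈p∪q⁺ (inj₁ (∈-select⁺ meetsTb? meets))
    ... | no  _     | yes large = x∈p∪q⁺ (inj₂ (x∈p∪q⁺ (inj₁ (∈-select⁺ large? large))))
    ... | no  ¬meets | no ¬large = x∈p∪q⁺ (inj₂ (x∈p∪q⁺ (inj₂
          (∈-⋃⊆⁺ _ Z _ (neighbourhood⊆separator (comps i) N≡)
            (neighbourhood-nonempty connected (comps i) N≡ z∈Z)
            (∈-select⁺ (attachedTo? _) (¬meets , ¬large , refl))))))
      where
      N≡ : NeighbourhoodIs G (Cs i) (N G E? (Cs i))
      N≡ = N-spec G E? (Cs i)

    ∣A∣≤ : ∣ A ∣ ≤ (2 * q + 2) * (2 ^ k ∸ 1)
    ∣A∣≤ = begin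
      ∣ A ∣                        ≤⟨ ∣⋃⊆⁺∣≤ _ (∣attachedTo∣≤2q+1 z∈Z) Z ⟩
      (2 ^ ∣ Z ∣ ∸ 1) * (2 * q + 1) ≤⟨ *-mono-≤ (∸-monoˡ-≤ 1 (^-monoʳ-≤ 2 ∣Z∣≤k)) (+-monoʳ-≤ (2 * q) (n≤1+n 1)) ⟩
      (2 ^ k ∸ 1) * (2 * q + 2)     ≡⟨ *-comm (2 ^ k ∸ 1) (2 * q + 2) ⟩
      (2 * q + 2) * (2 ^ k ∸ 1)     ∎

    rearrange : ∀ t a → t + (1 + a) ≡ a + t + 1
    rearrange = solve-∀

lemma10 : ∀ {n} (G : Graph n) (Vinf Tb : Subset n) (q k : ℕ) →
    Connected G →
    ¬ HasGoodNodeSep G Vinf q k →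
    ¬ HasFlowerSep G Vinf Tb q k →
    (Z : Subset n) → DisjointFrom Z Vinf → ∣ Z ∣ ≤ k →
    ((ℓ : ℕ) (Cs : Fin ℓ → Subset n) →
       (∀ i → IsComponent G Z (Cs i)) →
       (∀ i j → Cs i ≡ Cs j → i ≡ j) →
       (∀ i → ∃ λ x → x ∈ Cs i × x ∉ Vinf) →
       ℓ ≤ (2 * q + 2) * (2 ^ k ∸ 1) + ∣ Tb ∣ + 1)
    ×
    (∀ C₁ C₂ → IsComponent G Z C₁ → IsComponent G Z C₂ →
       q < ∣ C₁ ∖ Vinf ∣ → q < ∣ C₂ ∖ Vinf ∣ → C₁ ≡ C₂)
lemma10 G Vinf Tb q k connected noGood noFlower Z Z∩Vinf=∅ ∣Z∣≤k =
  (λ ℓ Cs comps distinct wit → decidable-stable (ℓ ≤? _)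
    (¬¬-map (λ E? → Counting.count G Vinf Tb q k connected noGood noFlower Z∩Vinf=∅ ∣Z∣≤k E? Cs comps distinct wit)
      ¬¬E?)) ,
  large-components-unique G Vinf Tb q k noGood Z∩Vinf=∅ ∣Z∣≤k
  where
  -- The edge relation need not be decidable, but the bound is a decidable goal,
  -- so decidability of the finitely many edges may be assumed.
  ¬¬E? : ¬ ¬ (∀ x y → Dec (E G x y))
  ¬¬E? = sequence ¬¬-applicative (λ x → sequence ¬¬-applicative (λ y → ¬¬-excluded-middle))
    where
    open RawMonad ¬¬-Monad renaming (rawApplicative to ¬¬-applicative)
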